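{- Let $p$ be either $1$ or a prime. Then for all $n\ge 0$, $a_{p,2}(n+1)-a_{p,2}(n)=m_n(p)$. Moreover, $$\sum_{n\ge 0} m_n(p)\,q^n=\frac{q^p}{(1-q^p)(q;q)_\infty}.$$
   Context: A partition of $n$ is a weakly decreasing finite sequence of positive integers summing to $n$; $\mathcal P(n)$ is the set of partitions of $n$ (the empty partition being the unique partition of $0$). For a partition $\lambda$ and positive integer $i$, $m_\lambda(i)$ is the number of parts equal to $i$, and $m_n(i)=\sum_{\lambda\in\mathcal P(n)} m_\lambda(i)$ is the total number of parts equal to $i$ among all partitions of $n$. For $\lambda=(\lambda_1,\ldots,\lambda_\ell)$ with $\ell\ge 2$, $\mathrm{pre}_2(\lambda)$ is the partition whose parts are the $\binom{\ell}{2}$ products $\lambda_{i}\lambda_{j}$ over all $1\le i<j\le\ell$ (with multiplicity); it is undefined if $\ell<2$. $\mathrm{pre}_2(\mathcal P(n))$ is the set of $\mathrm{pre}_2(\lambda)$ for $\lambda\in\mathcal P(n)$ with at least $2$ parts, and $a_{i,2}(n)=\sum_{\nu\in\mathrm{pre}_2(\mathcal P(n))} m_\nu(i)$. Also $(q;q)_\infty=\prod_{j\ge1}(1-q^j)$. -}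

module Defs where

open import Data.Nat as ℕ using (ℕ; zero; suc; _≤_; _≥_; _≟_)
open import Data.Nat.Properties using (≤-decTotalOrder)
open import Data.Nat.ListAction using (sum)
open import Data.Integer as ℤ using (ℤ; +_)
open import Data.List using (List; []; _∷_; map; _++_; length; filter; reverse; deduplicate; upTo; foldr)
open import Data.List.Relation.Unary.All using (All)
open import Data.List.Relation.Unary.Linked using (Linked)
open import Data.List.Relation.Unary.Unique.Propositional using (Unique)
open import Data.List.Membership.Propositional using (_∈_)
open import Data.List.Properties using (≡-dec)
open import Data.Product using (_×_)
open import Data.Bool using (if_then_else_)
open import Function.Bundles using (_⇔_)
open import Relation.Nullary.Decidable using (⌊_⌋)
open import Relation.Binary.PropositionalEquality using (_≡_)
open import Data.List.Sort ≤-decTotalOrder using (sort)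

IsPartition : ℕ → List ℕ → Set
IsPartition n μ = Linked _≥_ μ × All (λ x → 1 ≤ x) μ × sum μ ≡ n

Enumerates : ℕ → List (List ℕ) → Set
Enumerates n L = Unique L × (∀ μ → (μ ∈ L) ⇔ IsPartition n μ)

mult : ℕ → List ℕ → ℕ
mult i λ′ = length (filter (_≟ i) λ′)

-- m_n(i), computed over an enumeration L of 𝒫(n)
mTotal : ℕ → List (List ℕ) → ℕ
mTotal i L = sum (map (mult i) L)

pairProducts : List ℕ → List ℕ
pairProducts []       = []
pairProducts (x ∷ xs) = map (x ℕ.*_) xs ++ pairProducts xs

pre2 : List ℕ → List ℕ
pre2 λ′ = reverse (sort (pairProducts λ′))

pre2Set : List (List ℕ) → List (List ℕ)
pre2Set L = deduplicate (≡-dec _≟_) (map pre2 (filter (λ μ → 2 ℕ.≤? length μ) L))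

-- a_{i,2}(n), computed over an enumeration L of 𝒫(n)
a2 : ℕ → List (List ℕ) → ℕ
a2 i L = sum (map (mult i) (pre2Set L))

PS : Set
PS = ℕ → ℤ

_*ₚ_ : PS → PS → PS
(f *ₚ g) n = foldr ℤ._+_ (+ 0) (map (λ k → f k ℤ.* g (n ℕ.∸ k)) (upTo (suc n)))

_-ₚ_ : PS → PS → PS
(f -ₚ g) n = f n ℤ.- g n

qPow : ℕ → PS
qPow k n = if ⌊ n ≟ k ⌋ then + 1 else + 0

qqFin : ℕ → PS
qqFin zero    = qPow 0
qqFin (suc N) = qqFin N *ₚ (qPow 0 -ₚ qPow (suc N))

-- (q;q)_∞ : its n-th coefficient equals that of ∏_{j=1}^{n} (1 - q^j)
qqInf : PS
qqInf n = qqFin n n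

-- Each pair of parts of μ whose product is p contributes to m_{pre₂(μ)}(p), so
-- a_{p,2}(n) = Σ_{μ ⊢ n} m_{pre₂(μ)}(p) provided pre₂ is injective on the partitions
-- that contribute. It is: the multiset of pairwise products of a partition containing a 1
-- determines the partition (the number of 1s from the number of products equal to 1, the
-- other parts by strong induction on their size). Since p is 1 or prime, a product of two
-- parts equals p only if one factor is 1; so m_{pre₂(μ)}(p) vanishes when μ has no part 1,
-- and adding a part 1 to ν raises it by m_ν(p). Adding a part 1 is a bijection from the
-- partitions of n onto those of n + 1 that contain a 1, whence
-- a_{p,2}(n + 1) = a_{p,2}(n) + m_n(p).
--
-- Adding a part p in the same way gives m_k(p) = p(k - p) + m_{k-p}(p), that is
-- (1 - q^p) Σ m_k(p) q^k = q^p Σ p(k) q^k. Euler's identity Σ p(k) q^k · (q;q)_∞ = 1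
-- is proved coefficientwise: adding a part N + 1 shows that the partitions with parts
-- at most N + 1 have generating function (1 - q^(N+1))⁻¹ times that of the partitions
-- with parts at most N, and the N-th truncation of (q;q)_∞ is exact below degree N + 1.

module Submission where

open import Defs

open import Data.Bool using (if_then_else_)
open import Data.List
  using (List; []; _∷_; [_]; map; _++_; length; filter; deduplicate; foldr; applyUpTo; upTo)
open import Data.List.Membership.Propositional using (_∈_; _∉_)
open import Data.List.Membership.Propositional.Properties
  using (∈-filter⁺; ∈-filter⁻; ∈-length; ∈-∃++; ∈-deduplicate⁻; ∈-++⁻; ∈-map⁺; ∈-map⁻)
open import Data.List.Membership.Propositional.Properties.WithK using (unique∧set⇒bag)
open import Data.List.Properties
  using ( filter-++; length-++; filter-none; filter-accept; filter-reject
        ; map-cong; map-cong-local; map-id; map-∘; map-upTo; ≡-dec )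
open import Data.List.Relation.Binary.BagAndSetEquality using (∼bag⇒↭)
import Data.List.Relation.Binary.Permutation.Propositional as ↭
open import Data.List.Relation.Binary.Permutation.Propositional
  using (_↭_; ↭-refl; ↭-sym; ↭-trans; ↭-reflexive; ↭⇒↭ₛ; module PermutationReasoning)
open import Data.List.Relation.Binary.Permutation.Propositional.Properties
  using (↭-length; filter-↭; drop-∷; All-resp-↭; ∈-resp-↭; map⁺; ++⁺; shifts; ↭-reverse)
  renaming (shift to ↭-shift)
open import Data.List.Relation.Binary.Pointwise using (Pointwise-≡⇒≡)
open import Data.List.Relation.Unary.All as All using (All; []; _∷_)
open import Data.List.Relation.Unary.AllPairs using (AllPairs; []; _∷_)
import Data.List.Relation.Unary.AllPairs.Properties as AllPairs
open import Data.List.Relation.Unary.Any using (here; there)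
open import Data.List.Relation.Unary.Linked using ([]; tail)
open import Data.List.Relation.Unary.Unique.Propositional using (Unique)
import Data.List.Relation.Unary.Unique.Propositional.Properties as Unique
open import Data.Nat
  using (ℕ; zero; suc; _∸_; _≤_; _<_; z≤n; s≤s; z<s; s<s; _≟_; _≤?_; _<?_; >-nonZero; >-nonZero⁻¹)
open import Data.Nat.Divisibility using (divides)
open import Data.Nat.Induction using (<-rec)
open import Data.Nat.ListAction using (sum)
open import Data.Nat.ListAction.Properties using (sum-↭)
open import Data.Nat.Primality
  using (Prime; Irreducible; irreducible⇒nonZero; irreducible[1]; prime⇒irreducible)
open import Data.Nat.Properties
open import Data.Product using (_×_; _,_; ∃-syntax; proj₁; proj₂)
open import Data.Sum using (_⊎_; inj₁; inj₂; [_,_]′)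
open import Function using (_∘_)
open import Function.Bundles using (_⇔_; mk⇔; Equivalence)
open import Relation.Binary using (DecidableEquality; tri<; tri≈; tri>)
open import Relation.Binary.Bundles using (DecTotalOrder)
open import Relation.Binary.PropositionalEquality hiding ([_])
open import Relation.Binary.Properties.DecTotalOrder ≤-decTotalOrder using (≥-decTotalOrder)
open import Relation.Nullary using (¬_; Dec; yes; no; contradiction)
open import Relation.Nullary.Decidable using (⌊_⌋; decidable-stable; ¬?)
open import Relation.Unary using (Decidable)

open import Data.List.Membership.DecPropositional _≟_ using (_∈?_)
open DecTotalOrder ≥-decTotalOrder using () renaming (totalOrder to ≥-totalOrder)
open import Data.List.Relation.Unary.Sorted.TotalOrder ≥-totalOrder using (Sorted)
import Data.List.Relation.Unary.Sorted.TotalOrder.Properties as Sorted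
open import Data.List.Sort ≤-decTotalOrder using () renaming (sort-↭ to ≤-sort-↭)
open import Data.List.Sort.InsertionSort ≥-decTotalOrder using (insert; sort)
open import Data.List.Sort.InsertionSort.Properties ≥-decTotalOrder
  using (insert-↭; insert-↗; sort-↭; sort-↗)

-- Formal power series

module PowerSeries where

  open import Data.Integer using (ℤ; +_; _+_; _*_; _-_)
  import Data.Integer.Properties as ℤ
  open import Data.Integer.Tactic.RingSolver using (solve-∀)

  Σ< : (ℕ → ℤ) → ℕ → ℤ
  Σ< F n = foldr _+_ (+ 0) (applyUpTo F n)

  Σ<-cong : ∀ {F G} n → (∀ k → k < n → F k ≡ G k) → Σ< F n ≡ Σ< G n
  Σ<-cong zero    _ = refl
  Σ<-cong (suc n) h = cong₂ _+_ (h 0 z<s) (Σ<-cong n λ k k<n → h (suc k) (s<s k<n))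

  Σ<-zero : ∀ {F} n → (∀ k → k < n → F k ≡ + 0) → Σ< F n ≡ + 0
  Σ<-zero zero    _ = refl
  Σ<-zero (suc n) h = cong₂ _+_ (h 0 z<s) (Σ<-zero n λ k k<n → h (suc k) (s<s k<n))

  Σ<-sub : ∀ F G n → Σ< (λ k → F k - G k) n ≡ Σ< F n - Σ< G n
  Σ<-sub F G zero    = refl
  Σ<-sub F G (suc n) = begin
    (F 0 - G 0) + Σ< (λ k → F (suc k) - G (suc k)) n   ≡⟨ cong (_+_ (F 0 - G 0)) (Σ<-sub F′ G′ n) ⟩
    (F 0 - G 0) + (Σ< F′ n - Σ< G′ n)                  ≡⟨ regroup (F 0) (G 0) (Σ< F′ n) (Σ< G′ n) ⟩
    (F 0 + Σ< F′ n) - (G 0 + Σ< G′ n)                  ∎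
    where
    open ≡-Reasoning
    F′ G′ : ℕ → ℤ
    F′ k = F (suc k)
    G′ k = G (suc k)
    regroup : ∀ a b c d → (a - b) + (c - d) ≡ (a + c) - (b + d)
    regroup = solve-∀

  Σ<-snoc : ∀ F n → Σ< F (suc n) ≡ Σ< F n + F n
  Σ<-snoc F zero    = ℤ.+-comm (F 0) (+ 0)
  Σ<-snoc F (suc n) =
    trans (cong (_+_ (F 0)) (Σ<-snoc (λ k → F (suc k)) n)) (sym (ℤ.+-assoc (F 0) _ _))

  *ₚ-coeff : ∀ f g n → (f *ₚ g) n ≡ Σ< (λ k → f k * g (n ∸ k)) (suc n)
  *ₚ-coeff f g n = cong (foldr _+_ (+ 0)) (map-upTo (λ k → f k * g (n ∸ k)) (suc n))

  *ₚ-cong-≤ : ∀ {f f′ g g′} n → (∀ k → k ≤ n → f k ≡ f′ k) → (∀ k → k ≤ n → g k ≡ g′ k) →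
              (f *ₚ g) n ≡ (f′ *ₚ g′) n
  *ₚ-cong-≤ {f} {f′} {g} {g′} n f≡f′ g≡g′ = begin
      (f *ₚ g) n
    ≡⟨ *ₚ-coeff f g n ⟩
      Σ< (λ k → f k * g (n ∸ k)) (suc n)
    ≡⟨ Σ<-cong (suc n) (λ k k<1+n → cong₂ _*_ (f≡f′ k (≤-pred k<1+n)) (g≡g′ (n ∸ k) (m∸n≤m n k))) ⟩
      Σ< (λ k → f′ k * g′ (n ∸ k)) (suc n)
    ≡⟨ *ₚ-coeff f′ g′ n ⟨
      (f′ *ₚ g′) n
    ∎
    where open ≡-Reasoning

  *ₚ-congˡ : ∀ {f f′} g → f ≗ f′ → (f *ₚ g) ≗ (f′ *ₚ g)
  *ₚ-congˡ {f} {f′} g f≗f′ n = *ₚ-cong-≤ {f} {f′} {g} {g} n (λ k _ → f≗f′ k) (λ _ _ → refl)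

  *ₚ-congʳ : ∀ f {g g′} → g ≗ g′ → (f *ₚ g) ≗ (f *ₚ g′)
  *ₚ-congʳ f {g} {g′} g≗g′ n = *ₚ-cong-≤ {f} {f} {g} {g′} n (λ _ _ → refl) (λ k _ → g≗g′ k)

  *ₚ-distribˡ-sub : ∀ f g h → (f *ₚ (g -ₚ h)) ≗ ((f *ₚ g) -ₚ (f *ₚ h))
  *ₚ-distribˡ-sub f g h n = begin
      (f *ₚ (g -ₚ h)) n
    ≡⟨ *ₚ-coeff f (g -ₚ h) n ⟩
      Σ< (λ k → f k * (g (n ∸ k) - h (n ∸ k))) (suc n)
    ≡⟨ Σ<-cong (suc n) (λ k _ → distrib (f k) (g (n ∸ k)) (h (n ∸ k))) ⟩
      Σ< (λ k → f k * g (n ∸ k) - f k * h (n ∸ k)) (suc n)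
    ≡⟨ Σ<-sub (λ k → f k * g (n ∸ k)) (λ k → f k * h (n ∸ k)) (suc n) ⟩
      Σ< (λ k → f k * g (n ∸ k)) (suc n) - Σ< (λ k → f k * h (n ∸ k)) (suc n)
    ≡⟨ cong₂ _-_ (*ₚ-coeff f g n) (*ₚ-coeff f h n) ⟨
      (f *ₚ g) n - (f *ₚ h) n
    ∎
    where
    open ≡-Reasoning
    distrib : ∀ a b c → a * (b - c) ≡ a * b - a * c
    distrib = solve-∀

  *ₚ-distribʳ-sub : ∀ f g h → ((f -ₚ g) *ₚ h) ≗ ((f *ₚ h) -ₚ (g *ₚ h))
  *ₚ-distribʳ-sub f g h n = begin
      ((f -ₚ g) *ₚ h) n
    ≡⟨ *ₚ-coeff (f -ₚ g) h n ⟩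
      Σ< (λ k → (f k - g k) * h (n ∸ k)) (suc n)
    ≡⟨ Σ<-cong (suc n) (λ k _ → distrib (f k) (g k) (h (n ∸ k))) ⟩
      Σ< (λ k → f k * h (n ∸ k) - g k * h (n ∸ k)) (suc n)
    ≡⟨ Σ<-sub (λ k → f k * h (n ∸ k)) (λ k → g k * h (n ∸ k)) (suc n) ⟩
      Σ< (λ k → f k * h (n ∸ k)) (suc n) - Σ< (λ k → g k * h (n ∸ k)) (suc n)
    ≡⟨ cong₂ _-_ (*ₚ-coeff f h n) (*ₚ-coeff g h n) ⟨
      (f *ₚ h) n - (g *ₚ h) n
    ∎
    where
    open ≡-Reasoning
    distrib : ∀ a b c → (a - b) * c ≡ a * c - b * c
    distrib = solve-∀

  *ₚ-identityʳ : ∀ f → (f *ₚ qPow 0) ≗ f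
  *ₚ-identityʳ f zero    = unit (f 0)
    where
    unit : ∀ a → a * + 1 + + 0 ≡ a
    unit = solve-∀
  *ₚ-identityʳ f (suc n) = begin
      (f *ₚ qPow 0) (suc n)
    ≡⟨ *ₚ-coeff f (qPow 0) (suc n) ⟩
      Σ< (λ k → f k * qPow 0 (suc n ∸ k)) (suc (suc n))
    ≡⟨ Σ<-snoc (λ k → f k * qPow 0 (suc n ∸ k)) (suc n) ⟩
      Σ< (λ k → f k * qPow 0 (suc n ∸ k)) (suc n) + f (suc n) * qPow 0 (n ∸ n)
    ≡⟨ cong₂ _+_ (Σ<-zero (suc n) λ k k<1+n →
                   trans (cong (λ j → f k * qPow 0 j) (+-∸-assoc 1 (≤-pred k<1+n))) (ℤ.*-zeroʳ (f k)))
                 (cong (λ j → f (suc n) * qPow 0 j) (n∸n≡0 n)) ⟩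
      + 0 + f (suc n) * + 1
    ≡⟨ trans (ℤ.+-identityˡ _) (ℤ.*-identityʳ (f (suc n))) ⟩
      f (suc n)
    ∎
    where open ≡-Reasoning

  shift : ℕ → PS → PS
  shift zero    f n       = f n
  shift (suc m) f zero    = + 0
  shift (suc m) f (suc n) = shift m f n

  shift-≥ : ∀ {m n} f → m ≤ n → shift m f n ≡ f (n ∸ m)
  shift-≥ f z≤n       = refl
  shift-≥ f (s≤s m≤n) = shift-≥ f m≤n

  shift-< : ∀ {m n} f → n < m → shift m f n ≡ + 0
  shift-< {suc m} {zero}  f _         = refl
  shift-< {suc m} {suc n} f (s<s n<m) = shift-< f n<m

  shift-sub : ∀ m f g → shift m (f -ₚ g) ≗ (shift m f -ₚ shift m g)
  shift-sub zero    f g n       = refl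
  shift-sub (suc m) f g zero    = refl
  shift-sub (suc m) f g (suc n) = shift-sub m f g n

  shift-cong : ∀ m {f g} → f ≗ g → shift m f ≗ shift m g
  shift-cong zero    f≗g n       = f≗g n
  shift-cong (suc m) f≗g zero    = refl
  shift-cong (suc m) f≗g (suc n) = shift-cong m f≗g n

  shift-suc : ∀ m f → shift (suc m) f ≗ shift 1 (shift m f)
  shift-suc m f zero    = refl
  shift-suc m f (suc n) = refl

  qPow-≡ : ∀ m → qPow m m ≡ + 1
  qPow-≡ m = indicator (m ≟ m)
    where
    indicator : (d : Dec (m ≡ m)) → (if ⌊ d ⌋ then + 1 else + 0) ≡ + 1
    indicator (yes _)  = refl
    indicator (no m≢m) = contradiction refl m≢m

  qPow-≢ : ∀ {m n} → n ≢ m → qPow m n ≡ + 0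
  qPow-≢ {m} {n} n≢m = indicator (n ≟ m)
    where
    indicator : (d : Dec (n ≡ m)) → (if ⌊ d ⌋ then + 1 else + 0) ≡ + 0
    indicator (yes n≡m) = contradiction n≡m n≢m
    indicator (no _)    = refl

  qPow-suc : ∀ m n → qPow (suc m) (suc n) ≡ qPow m n
  qPow-suc m n with n ≟ m
  ... | yes refl = qPow-≡ (suc n)
  ... | no  n≢m  = qPow-≢ (n≢m ∘ suc-injective)

  shift-qPow : ∀ m → shift m (qPow 0) ≗ qPow m
  shift-qPow zero    n       = refl
  shift-qPow (suc m) zero    = refl
  shift-qPow (suc m) (suc n) = trans (shift-qPow m n) (sym (qPow-suc m n))

  *ₚ-shiftˡ : ∀ m f g → (shift m f *ₚ g) ≗ shift m (f *ₚ g)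
  *ₚ-shiftˡ zero    f g n       = refl
  *ₚ-shiftˡ (suc m) f g zero    = refl
  *ₚ-shiftˡ (suc m) f g (suc n) = begin
    (shift (suc m) f *ₚ g) (suc n)                    ≡⟨ *ₚ-coeff (shift (suc m) f) g (suc n) ⟩
    + 0 + Σ< (λ k → shift m f k * g (n ∸ k)) (suc n)  ≡⟨ ℤ.+-identityˡ _ ⟩
    Σ< (λ k → shift m f k * g (n ∸ k)) (suc n)        ≡⟨ *ₚ-coeff (shift m f) g n ⟨
    (shift m f *ₚ g) n                                ≡⟨ *ₚ-shiftˡ m f g n ⟩
    shift m (f *ₚ g) n                                ∎
    where open ≡-Reasoning

  *ₚ-shift1ʳ : ∀ f g → (f *ₚ shift 1 g) ≗ shift 1 (f *ₚ g)
  *ₚ-shift1ʳ f g zero    = trans (ℤ.+-identityʳ _) (ℤ.*-zeroʳ (f 0))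
  *ₚ-shift1ʳ f g (suc n) = begin
      (f *ₚ shift 1 g) (suc n)
    ≡⟨ *ₚ-coeff f (shift 1 g) (suc n) ⟩
      Σ< (λ k → f k * shift 1 g (suc n ∸ k)) (suc (suc n))
    ≡⟨ Σ<-snoc (λ k → f k * shift 1 g (suc n ∸ k)) (suc n) ⟩
      Σ< (λ k → f k * shift 1 g (suc n ∸ k)) (suc n) + f (suc n) * shift 1 g (n ∸ n)
    ≡⟨ cong₂ _+_ (Σ<-cong (suc n) λ k k<1+n →
                   cong (λ j → f k * shift 1 g j) (+-∸-assoc 1 (≤-pred k<1+n)))
                 (cong (λ j → f (suc n) * shift 1 g j) (n∸n≡0 n)) ⟩
      Σ< (λ k → f k * g (n ∸ k)) (suc n) + f (suc n) * + 0
    ≡⟨ trans (cong (_+_ (Σ< (λ k → f k * g (n ∸ k)) (suc n))) (ℤ.*-zeroʳ (f (suc n))))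
             (ℤ.+-identityʳ _) ⟩
      Σ< (λ k → f k * g (n ∸ k)) (suc n)
    ≡⟨ *ₚ-coeff f g n ⟨
      (f *ₚ g) n
    ∎
    where open ≡-Reasoning

  *ₚ-shiftʳ : ∀ m f g → (f *ₚ shift m g) ≗ shift m (f *ₚ g)
  *ₚ-shiftʳ zero    f g n = refl
  *ₚ-shiftʳ (suc m) f g n = begin
    (f *ₚ shift (suc m) g) n         ≡⟨ *ₚ-congʳ f (shift-suc m g) n ⟩
    (f *ₚ shift 1 (shift m g)) n     ≡⟨ *ₚ-shift1ʳ f (shift m g) n ⟩
    shift 1 (f *ₚ shift m g) n       ≡⟨ shift-cong 1 (*ₚ-shiftʳ m f g) n ⟩
    shift 1 (shift m (f *ₚ g)) n     ≡⟨ shift-suc m (f *ₚ g) n ⟨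
    shift (suc m) (f *ₚ g) n         ∎
    where open ≡-Reasoning

  *ₚ-qPow : ∀ m f → (f *ₚ qPow m) ≗ shift m f
  *ₚ-qPow m f n = begin
    (f *ₚ qPow m) n                  ≡⟨ *ₚ-congʳ f (λ k → sym (shift-qPow m k)) n ⟩
    (f *ₚ shift m (qPow 0)) n        ≡⟨ *ₚ-shiftʳ m f (qPow 0) n ⟩
    shift m (f *ₚ qPow 0) n          ≡⟨ shift-cong m (*ₚ-identityʳ f) n ⟩
    shift m f n                      ∎
    where open ≡-Reasoning

  *ₚ-1-qPow : ∀ m f → (f *ₚ (qPow 0 -ₚ qPow m)) ≗ (f -ₚ shift m f)
  *ₚ-1-qPow m f n = trans (*ₚ-distribˡ-sub f (qPow 0) (qPow m) n)
                          (cong₂ _-_ (*ₚ-identityʳ f n) (*ₚ-qPow m f n))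

  -- The one instance of associativity and commutativity of _*ₚ_ that the Euler product needs.
  *ₚ-1-qPow-swap : ∀ m f g → (f *ₚ (g *ₚ (qPow 0 -ₚ qPow m))) ≗ ((f *ₚ (qPow 0 -ₚ qPow m)) *ₚ g)
  *ₚ-1-qPow-swap m f g n = begin
    (f *ₚ (g *ₚ (qPow 0 -ₚ qPow m))) n    ≡⟨ *ₚ-congʳ f (*ₚ-1-qPow m g) n ⟩
    (f *ₚ (g -ₚ shift m g)) n             ≡⟨ *ₚ-distribˡ-sub f g (shift m g) n ⟩
    (f *ₚ g) n - (f *ₚ shift m g) n       ≡⟨ cong (_-_ ((f *ₚ g) n)) (*ₚ-shiftʳ m f g n) ⟩
    (f *ₚ g) n - shift m (f *ₚ g) n       ≡⟨ cong (_-_ ((f *ₚ g) n)) (*ₚ-shiftˡ m f g n) ⟨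
    (f *ₚ g) n - (shift m f *ₚ g) n       ≡⟨ *ₚ-distribʳ-sub f (shift m f) g n ⟨
    ((f -ₚ shift m f) *ₚ g) n             ≡⟨ *ₚ-congˡ g (*ₚ-1-qPow m f) n ⟨
    ((f *ₚ (qPow 0 -ₚ qPow m)) *ₚ g) n    ∎
    where open ≡-Reasoning

  qqFin-suc : ∀ N {n} → n < suc N → qqFin (suc N) n ≡ qqFin N n
  qqFin-suc N {n} n<1+N = begin
    qqFin (suc N) n                          ≡⟨ *ₚ-1-qPow (suc N) (qqFin N) n ⟩
    qqFin N n - shift (suc N) (qqFin N) n    ≡⟨ cong (_-_ (qqFin N n)) (shift-< (qqFin N) n<1+N) ⟩
    qqFin N n - + 0                          ≡⟨ ℤ.+-identityʳ (qqFin N n) ⟩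
    qqFin N n                                ∎
    where open ≡-Reasoning

  qqFin-stable : ∀ d n → qqFin (d Data.Nat.+ n) n ≡ qqInf n
  qqFin-stable zero    n = refl
  qqFin-stable (suc d) n = trans (qqFin-suc (d Data.Nat.+ n) (s≤s (m≤n+m n d))) (qqFin-stable d n)

open PowerSeries

-- Opened only now, so that they do not clash with the integer operations inside PowerSeries.
open import Data.Nat using (_+_; _*_)
open import Data.Nat.Tactic.RingSolver using (solve-∀)
open import Algebra.Properties.CommutativeSemigroup +-commutativeSemigroup using (interchange)

-- Multiplicities and sums over lists

𝟙 : {A : Set} → Dec A → ℕ
𝟙 (yes _) = 1
𝟙 (no _)  = 0

𝟙-cong : {A B : Set} → A ⇔ B → (a : Dec A) (b : Dec B) → 𝟙 a ≡ 𝟙 b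
𝟙-cong _   (yes _) (yes _) = refl
𝟙-cong A⇔B (yes a) (no ¬b) = contradiction (Equivalence.to A⇔B a) ¬b
𝟙-cong A⇔B (no ¬a) (yes b) = contradiction (Equivalence.from A⇔B b) ¬a
𝟙-cong _   (no _)  (no _)  = refl

𝟙-yes : {A : Set} → A → (a : Dec A) → 𝟙 a ≡ 1
𝟙-yes _ (yes _)  = refl
𝟙-yes a (no ¬a) = contradiction a ¬a

𝟙-no : {A : Set} → ¬ A → (a : Dec A) → 𝟙 a ≡ 0
𝟙-no ¬a (yes a) = contradiction a ¬a
𝟙-no _  (no _)  = refl

mult-∷ : ∀ i x xs → mult i (x ∷ xs) ≡ 𝟙 (x ≟ i) + mult i xs
mult-∷ i x xs with x ≟ i
... | yes x≡i = cong length (filter-accept (_≟ i) x≡i)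
... | no  x≢i = cong length (filter-reject (_≟ i) x≢i)

mult-++ : ∀ i xs ys → mult i (xs ++ ys) ≡ mult i xs + mult i ys
mult-++ i xs ys = trans (cong length (filter-++ (_≟ i) xs ys)) (length-++ (filter (_≟ i) xs))

mult-↭ : ∀ i {xs ys} → xs ↭ ys → mult i xs ≡ mult i ys
mult-↭ i xs↭ys = ↭-length (filter-↭ (_≟ i) xs↭ys)

mult-∉ : ∀ {i xs} → i ∉ xs → mult i xs ≡ 0
mult-∉ {i} {xs} i∉xs =
  cong length (filter-none (_≟ i) (All.tabulate λ x∈xs x≡i → i∉xs (subst (_∈ xs) x≡i x∈xs)))

mult-∈ : ∀ {i xs} → i ∈ xs → 0 < mult i xs
mult-∈ {i} i∈xs = ∈-length (∈-filter⁺ (_≟ i) i∈xs refl)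

mult-map-filter : ∀ {P : ℕ → Set} (P? : Decidable P) (f : ℕ → ℕ) i xs →
                  (∀ {y} → ¬ P y → f y ≢ i) → mult i (map f (filter P? xs)) ≡ mult i (map f xs)
mult-map-filter P? f i []       _ = refl
mult-map-filter P? f i (x ∷ xs) h with P? x
... | yes _   = begin
  mult i (f x ∷ map f (filter P? xs))          ≡⟨ mult-∷ i (f x) _ ⟩
  𝟙 (f x ≟ i) + mult i (map f (filter P? xs))  ≡⟨ cong (𝟙 (f x ≟ i) +_) (mult-map-filter P? f i xs h) ⟩
  𝟙 (f x ≟ i) + mult i (map f xs)              ≡⟨ mult-∷ i (f x) _ ⟨
  mult i (f x ∷ map f xs)                      ∎
  where open ≡-Reasoning
... | no  ¬px = begin
  mult i (map f (filter P? xs))      ≡⟨ mult-map-filter P? f i xs h ⟩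
  mult i (map f xs)                  ≡⟨ cong (_+ mult i (map f xs)) (𝟙-no (h ¬px) (f x ≟ i)) ⟨
  𝟙 (f x ≟ i) + mult i (map f xs)    ≡⟨ mult-∷ i (f x) (map f xs) ⟨
  mult i (f x ∷ map f xs)            ∎
  where open ≡-Reasoning

mult-filter : ∀ {P : ℕ → Set} (P? : Decidable P) i xs → (∀ {y} → ¬ P y → y ≢ i) →
              mult i (filter P? xs) ≡ mult i xs
mult-filter P? i xs h = subst₂ (λ l l′ → mult i l ≡ mult i l′)
  (map-id (filter P? xs)) (map-id xs) (mult-map-filter P? (λ y → y) i xs h)

mult-map-injective : ∀ {f : ℕ → ℕ} → (∀ {x y} → f x ≡ f y → x ≡ y) →
                     ∀ i xs → mult (f i) (map f xs) ≡ mult i xs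
mult-map-injective         f-inj i []       = refl
mult-map-injective {f = f} f-inj i (x ∷ xs) = begin
  mult (f i) (f x ∷ map f xs)              ≡⟨ mult-∷ (f i) (f x) (map f xs) ⟩
  𝟙 (f x ≟ f i) + mult (f i) (map f xs)    ≡⟨ cong₂ _+_ (𝟙-cong (mk⇔ f-inj (cong f)) _ (x ≟ i))
                                                         (mult-map-injective f-inj i xs) ⟩
  𝟙 (x ≟ i) + mult i xs                    ≡⟨ mult-∷ i x xs ⟨
  mult i (x ∷ xs)                          ∎
  where open ≡-Reasoning

sum-map-+ : ∀ {A : Set} (f g : A → ℕ) xs →
            sum (map (λ x → f x + g x) xs) ≡ sum (map f xs) + sum (map g xs)
sum-map-+ f g []       = refl
sum-map-+ f g (x ∷ xs) =
  trans (cong (f x + g x +_) (sum-map-+ f g xs)) (interchange (f x) (g x) _ _)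

sum-map-zero : ∀ {A : Set} {f : A → ℕ} {xs} → All (λ x → f x ≡ 0) xs → sum (map f xs) ≡ 0
sum-map-zero []           = refl
sum-map-zero (fx≡0 ∷ fxs) = cong₂ _+_ fx≡0 (sum-map-zero fxs)

sum-map-filter : ∀ {A : Set} {P : A → Set} (P? : Decidable P) (f : A → ℕ) {xs} →
                 All (λ x → ¬ P x → f x ≡ 0) xs → sum (map f (filter P? xs)) ≡ sum (map f xs)
sum-map-filter P? f {[]}     []         = refl
sum-map-filter P? f {x ∷ xs} (fx ∷ fxs) with P? x
... | yes _   = cong (f x +_) (sum-map-filter P? f fxs)
... | no  ¬px = trans (sum-map-filter P? f fxs) (cong (_+ sum (map f xs)) (sym (fx ¬px)))

sum-map-bag : ∀ {A : Set} (f : A → ℕ) {xs ys : List A} → Unique xs → Unique ys →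
              (∀ {z} → z ∈ xs ⇔ z ∈ ys) → sum (map f xs) ≡ sum (map f ys)
sum-map-bag f !xs !ys xs≈ys = sum-↭ (map⁺ f (∼bag⇒↭ (unique∧set⇒bag !xs !ys xs≈ys)))

sum-deduplicate : ∀ {A : Set} (_≟ₐ_ : DecidableEquality A) (h : A → ℕ) {xs} →
                  AllPairs (λ x y → x ≡ y → h x ≡ 0) xs →
                  sum (map h (deduplicate _≟ₐ_ xs)) ≡ sum (map h xs)
sum-deduplicate _≟ₐ_ h {[]}     []         = refl
sum-deduplicate _≟ₐ_ h {x ∷ xs} (hx ∷ hxs) = cong (h x +_) (begin
  sum (map h (filter (¬? ∘ (x ≟ₐ_)) (deduplicate _≟ₐ_ xs)))
    ≡⟨ sum-map-filter (¬? ∘ (x ≟ₐ_)) h (All.tabulate duplicate) ⟩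
  sum (map h (deduplicate _≟ₐ_ xs))
    ≡⟨ sum-deduplicate _≟ₐ_ h hxs ⟩
  sum (map h xs) ∎)
  where
  open ≡-Reasoning
  duplicate : ∀ {z} → z ∈ deduplicate _≟ₐ_ xs → ¬ ¬ x ≡ z → h z ≡ 0
  duplicate {z} z∈ ¬x≢z with x≡z ← decidable-stable (x ≟ₐ z) ¬x≢z =
    subst (λ w → h w ≡ 0) x≡z (All.lookup hx (∈-deduplicate⁻ _≟ₐ_ xs z∈) x≡z)

AllPairs-restrict : ∀ {A : Set} {P : A → Set} {R S : A → A → Set} {xs} →
                    (∀ {x y} → P x → P y → R x y → S x y) →
                    All P xs → AllPairs R xs → AllPairs S xs
AllPairs-restrict f []         []         = []
AllPairs-restrict f (px ∷ pxs) (rx ∷ rxs) =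
  All.zipWith (λ (py , rxy) → f px py rxy) (pxs , rx) ∷ AllPairs-restrict f pxs rxs

-- Weakly decreasing lists and partitions

sorted-↭⇒≡ : ∀ {xs ys} → Sorted xs → Sorted ys → xs ↭ ys → xs ≡ ys
sorted-↭⇒≡ sxs sys xs↭ys = Pointwise-≡⇒≡ (Sorted.↗↭↗⇒≋ ≥-totalOrder sxs sys (↭⇒↭ₛ xs↭ys))

insert-injective : ∀ x {ys zs} → Sorted ys → Sorted zs → insert x ys ≡ insert x zs → ys ≡ zs
insert-injective x sys szs eq = sorted-↭⇒≡ sys szs (drop-∷
  (↭-trans (↭-sym (insert-↭ x _)) (↭-trans (↭-reflexive eq) (insert-↭ x _))))

mult-insert-self : ∀ x ν → mult x (insert x ν) ≡ 1 + mult x ν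
mult-insert-self x ν = trans (mult-↭ x (insert-↭ x ν))
  (trans (mult-∷ x x ν) (cong (_+ mult x ν) (𝟙-yes refl (x ≟ x))))

mult-above-head : ∀ {z zs v} → Sorted (z ∷ zs) → z < v → mult v (z ∷ zs) ≡ 0
mult-above-head s z<v with hd ∷ _ ← Sorted.Sorted⇒AllPairs ≥-totalOrder s =
  mult-∉ λ v∈ → <⇒≱ z<v (All.lookup (≤-refl ∷ hd) v∈)

sorted-mult-ext : ∀ {xs ys} → Sorted xs → Sorted ys → (∀ i → mult i xs ≡ mult i ys) → xs ≡ ys
sorted-mult-ext {[]}     {[]}     _  _  _ = refl
sorted-mult-ext {x ∷ xs} {[]}     _  _  h = contradiction (h x) (>⇒≢ (mult-∈ {x} {x ∷ xs} (here refl)))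
sorted-mult-ext {[]}     {y ∷ ys} _  _  h = contradiction (h y) (<⇒≢ (mult-∈ {y} {y ∷ ys} (here refl)))
sorted-mult-ext {x ∷ xs} {y ∷ ys} sx sy h with <-cmp x y
... | tri< x<y _ _ =
  contradiction (trans (sym (h y)) (mult-above-head sx x<y)) (>⇒≢ (mult-∈ {y} {y ∷ ys} (here refl)))
... | tri> _ _ y<x =
  contradiction (trans (h x) (mult-above-head sy y<x)) (>⇒≢ (mult-∈ {x} {x ∷ xs} (here refl)))
... | tri≈ _ refl _ = cong (x ∷_) (sorted-mult-ext (tail sx) (tail sy) λ i →
  +-cancelˡ-≡ (𝟙 (x ≟ i)) _ _ (trans (sym (mult-∷ i x xs)) (trans (h i) (mult-∷ i x ys))))

∈⇒≤sum : ∀ {x xs} → x ∈ xs → x ≤ sum xs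
∈⇒≤sum {xs = y ∷ ys} (here refl) = m≤m+n y (sum ys)
∈⇒≤sum {xs = y ∷ ys} (there x∈) = ≤-trans (∈⇒≤sum x∈) (m≤n+m (sum ys) y)

IsPartition-∈⇒≤ : ∀ {n μ x} → IsPartition n μ → x ∈ μ → x ≤ n
IsPartition-∈⇒≤ (_ , _ , Σμ≡n) x∈μ = subst (_ ≤_) Σμ≡n (∈⇒≤sum x∈μ)

insert-IsPartition : ∀ {x n ν} → 1 ≤ x → IsPartition n ν → IsPartition (x + n) (insert x ν)
insert-IsPartition {x} {n} {ν} 1≤x (sν , pos , Σν≡n) =
  insert-↗ x sν ,
  All-resp-↭ (↭-sym (insert-↭ x ν)) (1≤x ∷ pos) ,
  trans (sum-↭ (insert-↭ x ν)) (cong (x +_) Σν≡n)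

IsPartition-delete : ∀ {x n μ} → IsPartition (x + n) μ → x ∈ μ →
                     ∃[ ν ] IsPartition n ν × insert x ν ≡ μ
IsPartition-delete {x} {n} (sμ , pos , Σμ≡x+n) x∈μ with ys , zs , refl ← ∈-∃++ x∈μ =
  ν , (sort-↗ (ys ++ zs) , All-resp-↭ (↭-sym ν↭) (All.tail (All-resp-↭ μ↭ pos)) , Σν≡n) ,
  sorted-↭⇒≡ (insert-↗ x (sort-↗ (ys ++ zs))) sμ (↭-trans (insert-↭ x ν) x∷ν↭μ)
  where
  ν = sort (ys ++ zs)
  ν↭ : ν ↭ ys ++ zs
  ν↭ = sort-↭ (ys ++ zs)
  μ↭ : ys ++ [ x ] ++ zs ↭ x ∷ ys ++ zs
  μ↭ = ↭-shift x ys zs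
  x∷ν↭μ : x ∷ ν ↭ ys ++ [ x ] ++ zs
  x∷ν↭μ = ↭-trans (↭.prep x ν↭) (↭-sym μ↭)
  Σν≡n : sum ν ≡ n
  Σν≡n = +-cancelˡ-≡ x _ _ (trans (sum-↭ x∷ν↭μ) Σμ≡x+n)

bounded : ℕ → List ℕ → ℕ
bounded N μ = 𝟙 (All.all? (_≤? N) μ)

bounded-↭ : ∀ N {xs ys} → xs ↭ ys → bounded N xs ≡ bounded N ys
bounded-↭ N xs↭ys = 𝟙-cong (mk⇔ (All-resp-↭ xs↭ys) (All-resp-↭ (↭-sym xs↭ys))) _ _

bounded-insert : ∀ {N x} ν → x ≤ N → bounded N (insert x ν) ≡ bounded N ν
bounded-insert {N} {x} ν x≤N =
  trans (bounded-↭ N (insert-↭ x ν)) (𝟙-cong (mk⇔ All.tail (x≤N ∷_)) _ _)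

bounded-suc : ∀ N μ → bounded (suc N) μ ≡ bounded N μ + 𝟙 (suc N ∈? μ) * bounded (suc N) μ
bounded-suc N μ with suc N ∈? μ
... | yes N+1∈μ = sym (cong₂ _+_
  (𝟙-no (λ all≤N → 1+n≰n (All.lookup all≤N N+1∈μ)) (All.all? (_≤? N) μ))
  (*-identityˡ (bounded (suc N) μ)))
... | no  N+1∉μ = trans (𝟙-cong (mk⇔ below (All.map m≤n⇒m≤1+n)) _ _) (sym (+-identityʳ _))
  where
  below : All (_≤ suc N) μ → All (_≤ N) μ
  below all≤N+1 = All.tabulate λ {y} y∈μ →
    m<1+n⇒m≤n (≤∧≢⇒< (All.lookup all≤N+1 y∈μ) λ y≡N+1 → N+1∉μ (subst (_∈ μ) y≡N+1 y∈μ))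

-- Pairwise products

pairProducts-↭ : ∀ {xs ys} → xs ↭ ys → pairProducts xs ↭ pairProducts ys
pairProducts-↭ ↭.refl                   = ↭-refl
pairProducts-↭ (↭.prep x p)             = ++⁺ (map⁺ (x *_) p) (pairProducts-↭ p)
pairProducts-↭ (↭.trans p q)            = ↭-trans (pairProducts-↭ p) (pairProducts-↭ q)
pairProducts-↭ (↭.swap {xs} {ys} x y p) = begin
  x * y ∷ map (x *_) xs ++ map (y *_) xs ++ pairProducts xs
    ≡⟨ cong (_∷ map (x *_) xs ++ map (y *_) xs ++ pairProducts xs) (*-comm x y) ⟩
  y * x ∷ map (x *_) xs ++ map (y *_) xs ++ pairProducts xs
    ↭⟨ ↭.prep (y * x) (shifts (map (x *_) xs) (map (y *_) xs)) ⟩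
  y * x ∷ map (y *_) xs ++ map (x *_) xs ++ pairProducts xs
    ↭⟨ ↭.prep (y * x) (++⁺ (map⁺ (y *_) p) (++⁺ (map⁺ (x *_) p) (pairProducts-↭ p))) ⟩
  y * x ∷ map (y *_) ys ++ map (x *_) ys ++ pairProducts ys ∎
  where open PermutationReasoning

∈-pairProducts⁻ : ∀ {z} xs → z ∈ pairProducts xs → ∃[ x ] ∃[ y ] x ∈ xs × y ∈ xs × x * y ≡ z
∈-pairProducts⁻ (x ∷ xs) z∈ with ∈-++⁻ (map (x *_) xs) z∈
... | inj₁ z∈xxs with y , y∈xs , refl ← ∈-map⁻ (x *_) z∈xxs = x , y , here refl , there y∈xs , refl
... | inj₂ z∈pxs with a , b , a∈ , b∈ , ab≡z ← ∈-pairProducts⁻ xs z∈pxs =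
  a , b , there a∈ , there b∈ , ab≡z

pairMult : ℕ → List ℕ → ℕ
pairMult i μ = mult i (pairProducts μ)

mult-pre2 : ∀ i μ → mult i (pre2 μ) ≡ pairMult i μ
mult-pre2 i μ = mult-↭ i (↭-trans (↭-reverse _) (≤-sort-↭ (pairProducts μ)))

pairMult-↭ : ∀ i {xs ys} → xs ↭ ys → pairMult i xs ≡ pairMult i ys
pairMult-↭ i xs↭ys = mult-↭ i (pairProducts-↭ xs↭ys)

map-1* : ∀ xs → map (1 *_) xs ≡ xs
map-1* xs = trans (map-cong *-identityˡ xs) (map-id xs)

pairMult-insert-1 : ∀ i ν → pairMult i (insert 1 ν) ≡ mult i ν + pairMult i ν
pairMult-insert-1 i ν = begin
  pairMult i (insert 1 ν)                    ≡⟨ pairMult-↭ i (insert-↭ 1 ν) ⟩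
  mult i (map (1 *_) ν ++ pairProducts ν)    ≡⟨ mult-++ i (map (1 *_) ν) _ ⟩
  mult i (map (1 *_) ν) + pairMult i ν       ≡⟨ cong (λ l → mult i l + pairMult i ν) (map-1* ν) ⟩
  mult i ν + pairMult i ν                    ∎
  where open ≡-Reasoning

irreducible-factor : ∀ {p x y} → Irreducible p → x * y ≡ p → x ≡ 1 ⊎ y ≡ 1
irreducible-factor {p} {x} {y} irr xy≡p with irr (divides y (trans (sym xy≡p) (*-comm x y)))
... | inj₁ x≡1 = inj₁ x≡1
... | inj₂ refl =
  inj₂ (*-cancelˡ-≡ y 1 x {{irreducible⇒nonZero irr}} (trans xy≡p (sym (*-identityʳ x))))

pairMult-∌1 : ∀ {p μ} → Irreducible p → 1 ∉ μ → pairMult p μ ≡ 0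
pairMult-∌1 {p} {μ} irr 1∉μ = mult-∉ factorisation
  where
  factorisation : p ∉ pairProducts μ
  factorisation p∈ with x , y , x∈ , y∈ , xy≡p ← ∈-pairProducts⁻ μ p∈ =
    [ (λ x≡1 → 1∉μ (subst (_∈ μ) x≡1 x∈)) , (λ y≡1 → 1∉μ (subst (_∈ μ) y≡1 y∈)) ]′
      (irreducible-factor irr xy≡p)

pairMult>0⇒1∈ : ∀ {p μ} → Irreducible p → 0 < pairMult p μ → 1 ∈ μ
pairMult>0⇒1∈ {μ = μ} irr pos with 1 ∈? μ
... | yes 1∈μ = 1∈μ
... | no  1∉μ = contradiction (pairMult-∌1 irr 1∉μ) (>⇒≢ pos)

choose2 : ℕ → ℕ
choose2 zero    = 0
choose2 (suc m) = m + choose2 m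

choose2-< : ∀ {m n} → 1 ≤ m → m < n → choose2 m < choose2 n
choose2-< {m} {suc n} 1≤m (s≤s m≤n) with m≤n⇒m<n∨m≡n m≤n
... | inj₁ m<n  = <-≤-trans (choose2-< 1≤m m<n) (m≤n+m (choose2 n) n)
... | inj₂ refl = +-monoˡ-< (choose2 m) 1≤m

choose2-injective : ∀ {m n} → 1 ≤ m → 1 ≤ n → choose2 m ≡ choose2 n → m ≡ n
choose2-injective {m} {n} 1≤m 1≤n eq with <-cmp m n
... | tri< m<n _ _ = contradiction eq (<⇒≢ (choose2-< 1≤m m<n))
... | tri≈ _ m≡n _ = m≡n
... | tri> _ _ n<m = contradiction eq (>⇒≢ (choose2-< 1≤n n<m))

pairMult-1 : ∀ xs → pairMult 1 xs ≡ choose2 (mult 1 xs)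
pairMult-1 []       = refl
pairMult-1 (x ∷ xs) with x ≟ 1
... | yes refl = begin
  mult 1 (map (1 *_) xs ++ pairProducts xs)  ≡⟨ mult-++ 1 (map (1 *_) xs) _ ⟩
  mult 1 (map (1 *_) xs) + pairMult 1 xs     ≡⟨ cong₂ _+_ (cong (mult 1) (map-1* xs)) (pairMult-1 xs) ⟩
  choose2 (suc (mult 1 xs))                  ≡⟨ cong choose2 (mult-∷ 1 1 xs) ⟨
  choose2 (mult 1 (1 ∷ xs))                  ∎
  where open ≡-Reasoning
... | no x≢1 = begin
  mult 1 (map (x *_) xs ++ pairProducts xs)  ≡⟨ mult-++ 1 (map (x *_) xs) _ ⟩
  mult 1 (map (x *_) xs) + pairMult 1 xs     ≡⟨ cong₂ _+_ (mult-∉ 1∉) (pairMult-1 xs) ⟩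
  choose2 (mult 1 xs)                        ≡⟨ cong (λ c → choose2 (c + mult 1 xs)) (𝟙-no x≢1 (x ≟ 1)) ⟨
  choose2 (𝟙 (x ≟ 1) + mult 1 xs)            ≡⟨ cong choose2 (mult-∷ 1 x xs) ⟨
  choose2 (mult 1 (x ∷ xs))                  ∎
  where
  open ≡-Reasoning
  1∉ : 1 ∉ map (x *_) xs
  1∉ 1∈ with _ , _ , 1≡xy ← ∈-map⁻ (x *_) 1∈ = x≢1 (m*n≡1⇒m≡1 x _ (sym 1≡xy))

*-≢-small-factor : ∀ {x y v} → x ≢ 1 → x < v → v ≤ y → x * y ≢ v
*-≢-small-factor {zero}        _   x<v _   = <⇒≢ x<v
*-≢-small-factor {suc zero}    x≢1 _   _   = contradiction refl x≢1
*-≢-small-factor {suc (suc x)} {y} {v} _ x<v v≤y = >⇒≢ (begin-strict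
  v                  ≤⟨ v≤y ⟩
  y                  <⟨ m<m+n y (<-≤-trans z<s (<-≤-trans x<v v≤y)) ⟩
  y + y              ≤⟨ +-monoʳ-≤ y (m≤m+n y (x * y)) ⟩
  y + (y + x * y)    ∎)
  where open ≤-Reasoning

*-≢-large-factor : ∀ {x y v} → 1 ≤ v → v < x → x * y ≢ v
*-≢-large-factor {x} {zero}  1≤v _   eq = <⇒≢ 1≤v (trans (sym (*-zeroʳ x)) eq)
*-≢-large-factor {x} {suc y} _   v<x    = >⇒≢ (<-≤-trans v<x (m≤m*n x (suc y)))

mult-map-*-below : ∀ {x v} → x < v → ∀ xs →
  mult v (map (x *_) xs) ≡ mult v (map (x *_) (filter (_<? v) xs)) + 𝟙 (x ≟ 1) * mult v xs
mult-map-*-below {x} {v} x<v xs with x ≟ 1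
... | yes refl = begin
  mult v (map (1 *_) xs)                                   ≡⟨ cong (mult v) (map-1* xs) ⟩
  mult v xs                                                ≡⟨ *-identityˡ (mult v xs) ⟨
  1 * mult v xs                                            ≡⟨ cong (_+ 1 * mult v xs) (mult-∉ v∉) ⟨
  mult v (map (1 *_) (filter (_<? v) xs)) + 1 * mult v xs  ∎
  where
  open ≡-Reasoning
  v∉ : v ∉ map (1 *_) (filter (_<? v) xs)
  v∉ v∈ with y , y∈ , refl ← ∈-map⁻ (1 *_) v∈ =
    <⇒≢ (proj₂ (∈-filter⁻ (_<? v) {xs = xs} y∈)) (sym (*-identityˡ y))
... | no x≢1 = trans
  (sym (mult-map-filter (_<? v) (x *_) v xs λ y≮v → *-≢-small-factor x≢1 x<v (≮⇒≥ y≮v)))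
  (sym (+-identityʳ _))

mult-map-*-above : ∀ {x v} → 1 ≤ v → v ≤ x → ∀ xs →
  mult v (map (x *_) xs) ≡ 𝟙 (x ≟ v) * mult 1 xs
mult-map-*-above {x} {v} 1≤v v≤x xs with x ≟ v
... | yes refl = begin
  mult x (map (x *_) xs)          ≡⟨ cong (λ w → mult w (map (x *_) xs)) (*-identityʳ x) ⟨
  mult (x * 1) (map (x *_) xs)    ≡⟨ mult-map-injective (*-cancelˡ-≡ _ _ x {{>-nonZero 1≤v}}) 1 xs ⟩
  mult 1 xs                       ≡⟨ *-identityˡ (mult 1 xs) ⟨
  1 * mult 1 xs                   ∎
  where open ≡-Reasoning
... | no x≢v = mult-∉ λ v∈ → let _ , _ , v≡xy = ∈-map⁻ (x *_) {xs = xs} v∈ in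
  *-≢-large-factor 1≤v (≤∧≢⇒< v≤x (≢-sym x≢v)) (sym v≡xy)

-- A pair of parts with product v ≥ 2 either has both parts below v or consists of 1 and v.
pairMult-split : ∀ {v} → 2 ≤ v → ∀ xs →
  pairMult v xs ≡ pairMult v (filter (_<? v) xs) + mult 1 xs * mult v xs
pairMult-split v≥2 []       = refl
pairMult-split {v} v≥2 (x ∷ xs) with x <? v
... | yes x<v = begin
    mult v (map (x *_) xs ++ pairProducts xs)
  ≡⟨ mult-++ v (map (x *_) xs) _ ⟩
    mult v (map (x *_) xs) + pairMult v xs
  ≡⟨ cong₂ _+_ (mult-map-*-below x<v xs) (pairMult-split v≥2 xs) ⟩
    (r + 𝟙 (x ≟ 1) * mv) + (pairMult v F + m₁ * mv)
  ≡⟨ regroup r _ (𝟙 (x ≟ 1)) m₁ mv ⟩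
    (r + pairMult v F) + (𝟙 (x ≟ 1) + m₁) * mv
  ≡⟨ cong (λ z → (r + pairMult v F) + (𝟙 (x ≟ 1) + m₁) * (z + mv)) (𝟙-no (<⇒≢ x<v) (x ≟ v)) ⟨
    (r + pairMult v F) + (𝟙 (x ≟ 1) + m₁) * (𝟙 (x ≟ v) + mv)
  ≡⟨ cong₂ _+_ (mult-++ v (map (x *_) F) _) (cong₂ _*_ (mult-∷ 1 x xs) (mult-∷ v x xs)) ⟨
    pairMult v (x ∷ F) + mult 1 (x ∷ xs) * mult v (x ∷ xs)
  ≡⟨ cong (λ l → pairMult v l + mult 1 (x ∷ xs) * mult v (x ∷ xs)) (filter-accept (_<? v) x<v) ⟨
    pairMult v (filter (_<? v) (x ∷ xs)) + mult 1 (x ∷ xs) * mult v (x ∷ xs)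
  ∎
  where
  open ≡-Reasoning
  F = filter (_<? v) xs
  r = mult v (map (x *_) F)
  m₁ = mult 1 xs
  mv = mult v xs
  regroup : ∀ a b c d e → (a + c * e) + (b + d * e) ≡ (a + b) + (c + d) * e
  regroup = solve-∀
... | no x≮v = begin
    mult v (map (x *_) xs ++ pairProducts xs)
  ≡⟨ mult-++ v (map (x *_) xs) _ ⟩
    mult v (map (x *_) xs) + pairMult v xs
  ≡⟨ cong₂ _+_ (mult-map-*-above (<-trans z<s v≥2) v≤x xs) (pairMult-split v≥2 xs) ⟩
    𝟙 (x ≟ v) * m₁ + (pairMult v F + m₁ * mv)
  ≡⟨ regroup (𝟙 (x ≟ v)) (pairMult v F) m₁ mv ⟩
    pairMult v F + m₁ * (𝟙 (x ≟ v) + mv)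
  ≡⟨ cong (λ z → pairMult v F + (z + m₁) * (𝟙 (x ≟ v) + mv)) (𝟙-no x≢1 (x ≟ 1)) ⟨
    pairMult v F + (𝟙 (x ≟ 1) + m₁) * (𝟙 (x ≟ v) + mv)
  ≡⟨ cong₂ (λ a b → pairMult v F + a * b) (mult-∷ 1 x xs) (mult-∷ v x xs) ⟨
    pairMult v F + mult 1 (x ∷ xs) * mult v (x ∷ xs)
  ≡⟨ cong (λ l → pairMult v l + mult 1 (x ∷ xs) * mult v (x ∷ xs)) (filter-reject (_<? v) x≮v) ⟨
    pairMult v (filter (_<? v) (x ∷ xs)) + mult 1 (x ∷ xs) * mult v (x ∷ xs)
  ∎
  where
  open ≡-Reasoning
  F = filter (_<? v) xs
  m₁ = mult 1 xs
  mv = mult v xs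
  v≤x = ≮⇒≥ x≮v
  x≢1 : x ≢ 1
  x≢1 refl = <⇒≱ v≥2 v≤x
  regroup : ∀ e b d m → e * d + (b + d * m) ≡ b + d * (e + m)
  regroup = solve-∀

mult-filter-< : ∀ {u v} → u < v → ∀ xs → mult u (filter (_<? v) xs) ≡ mult u xs
mult-filter-< {u} {v} u<v xs = mult-filter (_<? v) u xs λ y≮v y≡u → y≮v (subst (_< v) (sym y≡u) u<v)

mult-filter-≮ : ∀ {u v} → ¬ u < v → ∀ xs → mult u (filter (_<? v) xs) ≡ 0
mult-filter-≮ {u} {v} u≮v xs = mult-∉ λ u∈ → u≮v (proj₂ (∈-filter⁻ (_<? v) {xs = xs} u∈))

-- Strong induction on v: the multiplicities below v determine filter (_<? v) of the list, and
-- then pairMult-split recovers mult v, as mult 1 ≠ 0; mult 1 itself is read off pairMult 1.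
pairMult-injective : ∀ {a b} → Sorted a → Sorted b → All (1 ≤_) a → All (1 ≤_) b → 1 ∈ a → 1 ∈ b →
                     (∀ v → pairMult v a ≡ pairMult v b) → a ≡ b
pairMult-injective {a} {b} sa sb pos-a pos-b 1∈a 1∈b same = sorted-mult-ext sa sb (<-rec _ step)
  where
  0∉ : ∀ {xs} → All (1 ≤_) xs → 0 ∉ xs
  0∉ pos 0∈ = contradiction (All.lookup pos 0∈) λ ()
  step : ∀ v → (∀ {u} → u < v → mult u a ≡ mult u b) → mult v a ≡ mult v b
  step zero          _  = trans (mult-∉ (0∉ pos-a)) (sym (mult-∉ (0∉ pos-b)))
  step (suc zero)    _  = choose2-injective (mult-∈ 1∈a) (mult-∈ 1∈b)
    (trans (sym (pairMult-1 a)) (trans (same 1) (pairMult-1 b)))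
  step v@(suc (suc _)) ih = *-cancelˡ-≡ (mult v a) (mult v b) (mult 1 a) {{>-nonZero (mult-∈ 1∈a)}}
    (+-cancelˡ-≡ (pairMult v (filter (_<? v) a)) _ _ (begin
      pairMult v (filter (_<? v) a) + mult 1 a * mult v a  ≡⟨ pairMult-split v≥2 a ⟨
      pairMult v a                                         ≡⟨ same v ⟩
      pairMult v b                                         ≡⟨ pairMult-split v≥2 b ⟩
      pairMult v (filter (_<? v) b) + mult 1 b * mult v b  ≡⟨ cong₂ (λ l m → pairMult v l + m * mult v b)
                                                                     a<v≡b<v (ih v≥2) ⟨
      pairMult v (filter (_<? v) a) + mult 1 a * mult v b  ∎))
    where
    open ≡-Reasoning
    v≥2 : 2 ≤ v
    v≥2 = s≤s (s≤s z≤n)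
    below : ∀ u → mult u (filter (_<? v) a) ≡ mult u (filter (_<? v) b)
    below u with u <? v
    ... | yes u<v = trans (mult-filter-< u<v a) (trans (ih u<v) (sym (mult-filter-< u<v b)))
    ... | no  u≮v = trans (mult-filter-≮ u≮v a) (sym (mult-filter-≮ u≮v b))
    a<v≡b<v : filter (_<? v) a ≡ filter (_<? v) b
    a<v≡b<v = sorted-mult-ext (Sorted.filter⁺ ≥-totalOrder (_<? v) sa)
                              (Sorted.filter⁺ ≥-totalOrder (_<? v) sb) below

pre2-injective : ∀ {p m n a b} → Irreducible p → IsPartition m a → IsPartition n b →
                 0 < pairMult p a → pre2 a ≡ pre2 b → a ≡ b
pre2-injective {p} {a = a} {b} irr (sa , pos-a , _) (sb , pos-b , _) pa>0 pre2a≡pre2b =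
  pairMult-injective sa sb pos-a pos-b
    (pairMult>0⇒1∈ irr pa>0) (pairMult>0⇒1∈ irr (subst (0 <_) (same p) pa>0)) same
  where
  same : ∀ v → pairMult v a ≡ pairMult v b
  same v = trans (sym (mult-pre2 v a)) (trans (cong (mult v) pre2a≡pre2b) (mult-pre2 v b))

-- deduplicate in pre2Set only merges partitions whose pre₂ has no part equal to p.
a2≡∑pairMult : ∀ {p n L} → Irreducible p → Enumerates n L → a2 p L ≡ sum (map (pairMult p) L)
a2≡∑pairMult {p} {n} {L} irr (!L , L⇔) = begin
    sum (map (mult p) (deduplicate (≡-dec _≟_) (map pre2 L₂)))
  ≡⟨ sum-deduplicate (≡-dec _≟_) (mult p) distinct ⟩
    sum (map (mult p) (map pre2 L₂))
  ≡⟨ cong sum (map-∘ L₂) ⟨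
    sum (map (mult p ∘ pre2) L₂)
  ≡⟨ cong sum (map-cong (mult-pre2 p) L₂) ⟩
    sum (map (pairMult p) L₂)
  ≡⟨ sum-map-filter (λ μ → 2 ≤? length μ) (pairMult p) (All.tabulate short) ⟩
    sum (map (pairMult p) L)
  ∎
  where
  open ≡-Reasoning
  L₂ = filter (λ μ → 2 ≤? length μ) L
  short : ∀ {μ} → μ ∈ L → ¬ 2 ≤ length μ → pairMult p μ ≡ 0
  short {[]}        _ _   = refl
  short {_ ∷ []}    _ _   = refl
  short {_ ∷ _ ∷ _} _ ¬2≤ = contradiction (s≤s (s≤s z≤n)) ¬2≤
  collision : ∀ {a b} → IsPartition n a → IsPartition n b → a ≢ b → pre2 a ≡ pre2 b →
              mult p (pre2 a) ≡ 0
  collision {a} pa pb a≢b eq = decidable-stable (mult p (pre2 a) ≟ 0) λ ≢0 →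
    a≢b (pre2-injective irr pa pb (subst (0 <_) (mult-pre2 p a) (n≢0⇒n>0 ≢0)) eq)
  distinct : AllPairs (λ ρ σ → ρ ≡ σ → mult p ρ ≡ 0) (map pre2 L₂)
  distinct = AllPairs.map⁺ (AllPairs-restrict collision
    (All.tabulate λ μ∈ →
      Equivalence.to (L⇔ _) (proj₁ (∈-filter⁻ (λ μ → 2 ≤? length μ) {xs = L} μ∈)))
    (Unique.filter⁺ (λ μ → 2 ≤? length μ) !L))

-- Sums over the partitions of n

open import Data.Integer using (ℤ; +_; _-_)
import Data.Integer.Properties as ℤ

+[m+n]-+n≡+m : ∀ m n → + (m + n) - + n ≡ + m
+[m+n]-+n≡+m m n =
  trans (ℤ.[+m]-[+n]≡m⊖n (m + n) n) (trans (ℤ.⊖-≥ (m≤n+m n m)) (cong +_ (m+n∸n≡m m n)))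

module PartitionSums (E : ℕ → List (List ℕ)) (enum : ∀ n → Enumerates n (E n)) where

  ∑⊢ : ℕ → (List ℕ → ℕ) → ℕ
  ∑⊢ n F = sum (map F (E n))

  syntax ∑⊢ n (λ μ → F) = ∑[ μ ⊢ n ] F

  partition : ∀ {n μ} → μ ∈ E n → IsPartition n μ
  partition {n} {μ} = Equivalence.to (proj₂ (enum n) μ)

  member : ∀ {n μ} → IsPartition n μ → μ ∈ E n
  member {n} {μ} = Equivalence.from (proj₂ (enum n) μ)

  ∑-cong : ∀ {n F G} → (∀ {μ} → IsPartition n μ → F μ ≡ G μ) → ∑⊢ n F ≡ ∑⊢ n G
  ∑-cong F≡G = cong sum (map-cong-local (All.tabulate λ μ∈ → F≡G (partition μ∈)))

  ∑-empty : ∀ F → ∑⊢ 0 F ≡ F []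
  ∑-empty F = trans (sum-map-bag F (proj₁ (enum 0)) ([] ∷ []) (mk⇔ to from)) (+-identityʳ (F []))
    where
    to : ∀ {μ} → μ ∈ E 0 → μ ∈ [ [] ]
    to {[]}    _     = here refl
    to {x ∷ μ} x∷μ∈ with _ , 1≤x ∷ _ , _ ← partition x∷μ∈ =
      contradiction (IsPartition-∈⇒≤ (partition x∷μ∈) (here refl)) (<⇒≱ 1≤x)
    from : ∀ {μ} → μ ∈ [ [] ] → μ ∈ E 0
    from (here refl) = member ([] , [] , refl)

  -- Inserting x is a bijection from the partitions of n onto those of x + n that contain x.
  ∑-insert : ∀ {x n F} → 1 ≤ x → (∀ μ → x ∉ μ → F μ ≡ 0) → ∑⊢ (x + n) F ≡ ∑⊢ n (F ∘ insert x)
  ∑-insert {x} {n} {F} 1≤x vanish = begin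
      sum (map F (E (x + n)))
    ≡⟨ sum-map-filter (x ∈?_) F {xs = E (x + n)} (All.tabulate λ {μ} _ → vanish μ) ⟨
      sum (map F (filter (x ∈?_) (E (x + n))))
    ≡⟨ sum-map-bag F (Unique.filter⁺ (x ∈?_) (proj₁ (enum (x + n)))) inserted-unique (mk⇔ to from) ⟩
      sum (map F (map (insert x) (E n)))
    ≡⟨ cong sum (map-∘ (E n)) ⟨
      sum (map (F ∘ insert x) (E n))
    ∎
    where
    open ≡-Reasoning
    inserted-unique : Unique (map (insert x) (E n))
    inserted-unique = AllPairs.map⁺ (AllPairs-restrict
      (λ pν pν′ ν≢ν′ eq → ν≢ν′ (insert-injective x (proj₁ pν) (proj₁ pν′) eq))
      (All.tabulate partition) (proj₁ (enum n)))
    to : ∀ {μ} → μ ∈ filter (x ∈?_) (E (x + n)) → μ ∈ map (insert x) (E n)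
    to μ∈ with μ∈E , x∈μ ← ∈-filter⁻ (x ∈?_) {xs = E (x + n)} μ∈
          with ν , pν , refl ← IsPartition-delete (partition μ∈E) x∈μ = ∈-map⁺ (insert x) (member pν)
    from : ∀ {μ} → μ ∈ map (insert x) (E n) → μ ∈ filter (x ∈?_) (E (x + n))
    from μ∈ with ν , ν∈ , refl ← ∈-map⁻ (insert x) μ∈ =
      ∈-filter⁺ (x ∈?_) (member (insert-IsPartition 1≤x (partition ν∈)))
                        (∈-resp-↭ (↭-sym (insert-↭ x ν)) (here refl))

  ∑-shift : ∀ {x F} → 1 ≤ x → (∀ μ → x ∉ μ → F μ ≡ 0) →
            (λ k → + ∑⊢ k F) ≗ shift x (λ k → + ∑⊢ k (F ∘ insert x))
  ∑-shift {x} {F} 1≤x vanish k with x ≤? k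
  ... | yes x≤k = begin
    + ∑⊢ k F                                  ≡⟨ cong (λ j → + ∑⊢ j F) (m+[n∸m]≡n x≤k) ⟨
    + ∑⊢ (x + (k ∸ x)) F                      ≡⟨ cong +_ (∑-insert 1≤x vanish) ⟩
    + ∑⊢ (k ∸ x) (F ∘ insert x)               ≡⟨ shift-≥ (λ j → + ∑⊢ j (F ∘ insert x)) x≤k ⟨
    shift x (λ j → + ∑⊢ j (F ∘ insert x)) k   ∎
    where open ≡-Reasoning
  ... | no x≰k = trans
    (cong +_ (sum-map-zero (All.tabulate λ μ∈ →
      vanish _ λ x∈μ → x≰k (IsPartition-∈⇒≤ (partition μ∈) x∈μ))))
    (sym (shift-< _ (≰⇒> x≰k)))

  partitionCount : ℕ → ℕ
  partitionCount k = ∑[ μ ⊢ k ] 1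

  boundedCount : ℕ → ℕ → ℕ
  boundedCount N k = ∑[ μ ⊢ k ] bounded N μ

  boundedCount-0 : ∀ k → + boundedCount 0 k ≡ qPow 0 k
  boundedCount-0 zero    = cong +_ (∑-empty (bounded 0))
  boundedCount-0 (suc k) = cong +_ (sum-map-zero (All.tabulate nonempty))
    where
    nonempty : ∀ {μ} → μ ∈ E (suc k) → bounded 0 μ ≡ 0
    nonempty {[]}    μ∈ with () ← proj₂ (proj₂ (partition μ∈))
    nonempty {x ∷ μ} μ∈ with _ , 1≤x ∷ _ , _ ← partition μ∈ =
      𝟙-no (λ all≤0 → <⇒≱ 1≤x (All.head all≤0)) _

  boundedCount-suc : ∀ N →
    ((λ k → + boundedCount (suc N) k) -ₚ shift (suc N) (λ k → + boundedCount (suc N) k))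
      ≗ (λ k → + boundedCount N k)
  boundedCount-suc N k = begin
      + boundedCount (suc N) k - shift (suc N) B k
    ≡⟨ cong₂ _-_ (cong +_ split) (sym top) ⟩
      + (boundedCount N k + ∑⊢ k exactlyBounded) - + ∑⊢ k exactlyBounded
    ≡⟨ +[m+n]-+n≡+m (boundedCount N k) (∑⊢ k exactlyBounded) ⟩
      + boundedCount N k
    ∎
    where
    open ≡-Reasoning
    B : PS
    B k = + boundedCount (suc N) k
    exactlyBounded : List ℕ → ℕ
    exactlyBounded μ = 𝟙 (suc N ∈? μ) * bounded (suc N) μ
    split : boundedCount (suc N) k ≡ boundedCount N k + ∑⊢ k exactlyBounded
    split = trans (cong sum (map-cong (bounded-suc N) (E k))) (sum-map-+ (bounded N) exactlyBounded (E k))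
    exactlyBounded-insert : ∀ ν → exactlyBounded (insert (suc N) ν) ≡ bounded (suc N) ν
    exactlyBounded-insert ν = trans
      (cong₂ _*_ (𝟙-yes (∈-resp-↭ (↭-sym (insert-↭ (suc N) ν)) (here refl)) (suc N ∈? insert (suc N) ν))
                 (bounded-insert ν ≤-refl))
      (*-identityˡ (bounded (suc N) ν))
    top : + ∑⊢ k exactlyBounded ≡ shift (suc N) B k
    top = trans (∑-shift z<s (λ μ N+1∉μ → cong (_* bounded (suc N) μ) (𝟙-no N+1∉μ (suc N ∈? μ))) k)
                (shift-cong (suc N) (λ j → cong +_ (cong sum (map-cong exactlyBounded-insert (E j)))) k)

  boundedCount-large : ∀ {N k} → k ≤ N → boundedCount N k ≡ partitionCount k
  boundedCount-large k≤N =
    ∑-cong λ pμ → 𝟙-yes (All.tabulate λ y∈ → ≤-trans (IsPartition-∈⇒≤ pμ y∈) k≤N) _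

  boundedCount-euler : ∀ N → ((λ k → + boundedCount N k) *ₚ qqFin N) ≗ qPow 0
  boundedCount-euler zero    n = trans (*ₚ-identityʳ (λ k → + boundedCount 0 k) n) (boundedCount-0 n)
  boundedCount-euler (suc N) n = begin
      (B (suc N) *ₚ (qqFin N *ₚ (qPow 0 -ₚ qPow (suc N)))) n
    ≡⟨ *ₚ-1-qPow-swap (suc N) (B (suc N)) (qqFin N) n ⟩
      ((B (suc N) *ₚ (qPow 0 -ₚ qPow (suc N))) *ₚ qqFin N) n
    ≡⟨ *ₚ-congˡ (qqFin N) removeLargest n ⟩
      (B N *ₚ qqFin N) n
    ≡⟨ boundedCount-euler N n ⟩
      qPow 0 n
    ∎
    where
    open ≡-Reasoning
    B : ℕ → PS
    B N k = + boundedCount N k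
    removeLargest : (B (suc N) *ₚ (qPow 0 -ₚ qPow (suc N))) ≗ B N
    removeLargest k = trans (*ₚ-1-qPow (suc N) (B (suc N)) k) (boundedCount-suc N k)

  partitionCount-euler : ((λ k → + partitionCount k) *ₚ qqInf) ≗ qPow 0
  partitionCount-euler n = trans
    (*ₚ-cong-≤ n (λ k k≤n → cong +_ (sym (boundedCount-large k≤n))) truncation)
    (boundedCount-euler n n)
    where
    truncation : ∀ j → j ≤ n → qqInf j ≡ qqFin n j
    truncation j j≤n = trans (sym (qqFin-stable (n ∸ j) j)) (cong (λ N → qqFin N j) (m∸n+n≡m j≤n))

  mTotal-shift : ∀ {p} → 1 ≤ p →
    ((λ k → + mTotal p (E k)) -ₚ shift p (λ k → + mTotal p (E k))) ≗ shift p (λ k → + partitionCount k)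
  mTotal-shift {p} 1≤p k = begin
      M k - shift p M k
    ≡⟨ cong (_- shift p M k) (∑-shift 1≤p (λ μ → mult-∉) k) ⟩
      shift p (λ j → + ∑⊢ j (mult p ∘ insert p)) k - shift p M k
    ≡⟨ cong (_- shift p M k) (shift-cong p (λ j → cong +_ added-part) k) ⟩
      shift p (λ j → + (partitionCount j + mTotal p (E j))) k - shift p M k
    ≡⟨ shift-sub p _ M k ⟨
      shift p (λ j → + (partitionCount j + mTotal p (E j)) - M j) k
    ≡⟨ shift-cong p (λ j → +[m+n]-+n≡+m (partitionCount j) (mTotal p (E j))) k ⟩
      shift p (λ j → + partitionCount j) k
    ∎
    where
    open ≡-Reasoning
    M : PS
    M k = + mTotal p (E k)
    added-part : ∀ {j} → ∑⊢ j (mult p ∘ insert p) ≡ partitionCount j + mTotal p (E j)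
    added-part {j} = trans (cong sum (map-cong (mult-insert-self p) (E j)))
                           (sum-map-+ (λ _ → 1) (mult p) (E j))

  mTotal-generatingFunction : ∀ {p} → 1 ≤ p →
    (((λ k → + mTotal p (E k)) *ₚ (qPow 0 -ₚ qPow p)) *ₚ qqInf) ≗ qPow p
  mTotal-generatingFunction {p} 1≤p n = begin
    ((M *ₚ (qPow 0 -ₚ qPow p)) *ₚ qqInf) n   ≡⟨ *ₚ-congˡ qqInf (λ k → trans (*ₚ-1-qPow p M k)
                                                                             (mTotal-shift 1≤p k)) n ⟩
    (shift p P *ₚ qqInf) n                   ≡⟨ *ₚ-shiftˡ p P qqInf n ⟩
    shift p (P *ₚ qqInf) n                   ≡⟨ shift-cong p partitionCount-euler n ⟩
    shift p (qPow 0) n                       ≡⟨ shift-qPow p n ⟩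
    qPow p n                                 ∎
    where
    open ≡-Reasoning
    M P : PS
    M k = + mTotal p (E k)
    P k = + partitionCount k

  a2-difference : ∀ {p} → Irreducible p → ∀ n → + a2 p (E (suc n)) - + a2 p (E n) ≡ + mTotal p (E n)
  a2-difference {p} irr n = begin
      + a2 p (E (suc n)) - + a2 p (E n)
    ≡⟨ cong₂ (λ a b → + a - + b) (a2≡∑pairMult irr (enum (suc n))) (a2≡∑pairMult irr (enum n)) ⟩
      + ∑⊢ (suc n) (pairMult p) - + ∑⊢ n (pairMult p)
    ≡⟨ cong (λ a → + a - + ∑⊢ n (pairMult p)) (∑-insert ≤-refl (λ μ → pairMult-∌1 irr)) ⟩
      + ∑⊢ n (pairMult p ∘ insert 1) - + ∑⊢ n (pairMult p)
    ≡⟨ cong (λ a → + a - + ∑⊢ n (pairMult p)) added-one ⟩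
      + (mTotal p (E n) + ∑⊢ n (pairMult p)) - + ∑⊢ n (pairMult p)
    ≡⟨ +[m+n]-+n≡+m (mTotal p (E n)) (∑⊢ n (pairMult p)) ⟩
      + mTotal p (E n)
    ∎
    where
    open ≡-Reasoning
    added-one : ∑⊢ n (pairMult p ∘ insert 1) ≡ mTotal p (E n) + ∑⊢ n (pairMult p)
    added-one = trans (cong sum (map-cong (pairMult-insert-1 p) (E n)))
                      (sum-map-+ (mult p) (pairMult p) (E n))

corollary3p5 : (p : ℕ) → (p ≡ 1 ⊎ Prime p) →
    (E : ℕ → List (List ℕ)) → (∀ n → Enumerates n (E n)) →
    (∀ n → (+ a2 p (E (suc n))) - (+ a2 p (E n)) ≡ + mTotal p (E n))
    × (∀ n → (((λ k → + mTotal p (E k)) *ₚ (qPow 0 -ₚ qPow p)) *ₚ qqInf) n ≡ qPow p n)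
corollary3p5 p p≡1⊎prime E enum =
  a2-difference irr , mTotal-generatingFunction (>-nonZero⁻¹ p {{irreducible⇒nonZero irr}})
  where
  open PartitionSums E enum
  irr : Irreducible p
  irr = [ (λ { refl → irreducible[1] }) , prime⇒irreducible ]′ p≡1⊎prime
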